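{- Let $\mathcal{F} \subset \mathcal{P}([n])$ be an $r$-closed $\theta$-intersecting family, where $r \geq 3$ and $\theta \in (0,1)$. Suppose $S_{\mathrm{nor}} \neq \emptyset$. Let $i \in S_{\mathrm{exc}}$ with $i < i_{\max}$. If $\mathcal{F}(i) = \{A\}$, then either $|A \cap \mathrm{core}(\mathcal{F}(i_{\max}))| = \theta i$, or $\mathrm{core}(\mathcal{F}(i_{\max})) \subseteq A$. Moreover, there is at most one $i \in S_{\mathrm{exc}}$ with $i < i_{\max}$ for which the latter case holds.
   Context: A family $\mathcal{F} \subset \mathcal{P}([n])$ is $r$-closed $\theta$-intersecting if for each $2 \leq t \leq r$ and any $t$ distinct sets $A_1,\dots,A_t \in \mathcal{F}$ we have $|A_1 \cap \dots \cap A_t| \in \{\theta|A_1|, \dots, \theta|A_t|\}$. $\mathcal{F}(i) := \mathcal{F} \cap \binom{[n]}{i}$. For $A \in \mathcal{F}$, $\mathrm{Tor}(A) := \{B \in \mathcal{F} : |B| \geq |A|,\ |A \cap B| = \theta|A|\}$. When $\mathrm{Tor}(A) \neq \emptyset$, $\mathrm{core}(A) := A \cap B$ for any $B \in \mathrm{Tor}(A)$ (independent of the choice of $B$). $S := \{i \in [n] : \mathcal{F}(i) \neq \emptyset\}$, $S_{\mathrm{nor}} := \{i \in S : \mathrm{Tor}(A) \neq \emptyset \text{ for all } A \in \mathcal{F}(i)\}$, $S_{\mathrm{exc}} := S \setminus S_{\mathrm{nor}}$, $i_{\max} := \max S_{\mathrm{nor}}$. For $i \in S_{\mathrm{nor}}$,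 all sets in $\mathcal{F}(i)$ have the same core, denoted $\mathrm{core}(\mathcal{F}(i))$. -}

module Defs where

open import Data.Nat as ℕ using (ℕ; zero; suc; _≤_; _<_)
open import Data.Integer using (+_)
open import Data.Rational as ℚ using (ℚ; _/_; 0ℚ; 1ℚ)
open import Data.Fin using (Fin)
open import Data.Fin.Subset using (Subset; _∩_; ⊤; ∣_∣; _⊆_)
open import Data.Vec using (Vec; foldr; lookup)
open import Data.Product using (Σ; ∃; ∃-syntax; _×_; _,_)
open import Relation.Binary.PropositionalEquality using (_≡_)
open import Relation.Nullary using (¬_)
open import Function.Definitions using (Injective)

toℚ : ℕ → ℚ
toℚ k = (+ k) / 1

Family : ℕ → Set₁
Family n = Subset n → Set

-- intersection of a (nonempty in use) list of sets A₁ ∩ … ∩ A_t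
⋂ : ∀ {n t} → Vec (Subset n) t → Subset n
⋂ = foldr _ _∩_ ⊤

RClosedThetaIntersecting : ∀ {n} → ℕ → ℚ → Family n → Set
RClosedThetaIntersecting {n} r θ F =
  ∀ (t : ℕ) → 2 ≤ t → t ≤ r → (As : Vec (Subset n) t) →
  Injective _≡_ _≡_ (lookup As) → (∀ k → F (lookup As k)) →
  ∃[ k ] toℚ ∣ ⋂ As ∣ ≡ θ ℚ.* toℚ ∣ lookup As k ∣

InTor : ∀ {n} → ℚ → Family n → Subset n → Subset n → Set
InTor θ F A B = F B × ∣ A ∣ ≤ ∣ B ∣ × toℚ ∣ A ∩ B ∣ ≡ θ ℚ.* toℚ ∣ A ∣

InS : ∀ {n} → Family n → ℕ → Set
InS {n} F i = 1 ≤ i × i ≤ n × ∃[ A ] (F A × ∣ A ∣ ≡ i)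

InSnor : ∀ {n} → ℚ → Family n → ℕ → Set
InSnor {n} θ F i = InS F i × (∀ (A : Subset n) → F A → ∣ A ∣ ≡ i → ∃[ B ] InTor θ F A B)

InSexc : ∀ {n} → ℚ → Family n → ℕ → Set
InSexc θ F i = InS F i × ¬ InSnor θ F i

IsMaxSnor : ∀ {n} → ℚ → Family n → ℕ → Set
IsMaxSnor θ F m = InSnor θ F m × (∀ j → InSnor θ F j → j ≤ m)

-- C = core(F(i)) : C = A ∩ B for some A ∈ F(i) and B ∈ Tor(A)
-- (the paper's definition "for any such A, B")
IsCoreOf : ∀ {n} → ℚ → Family n → ℕ → Subset n → Set
IsCoreOf θ F i C = ∃[ A ] ∃[ B ] (F A × ∣ A ∣ ≡ i × InTor θ F A B × C ≡ A ∩ B)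

LayerIsSingleton : ∀ {n} → Family n → ℕ → Subset n → Set
LayerIsSingleton F i A = F A × ∣ A ∣ ≡ i × (∀ B → F B → ∣ B ∣ ≡ i → B ≡ A)

-- Let C = A′ ∩ B′ be the core of F(imax), so |C| = θ imax.  For a set A of a smaller
-- layer, the three distinct sets A, A′, B′ have |A ∩ C| ∈ {θ|A|, θ|A′|, θ|B′|}, and the
-- last two values are at least |C|, which forces C ⊆ A.  If C lay in two exceptional
-- singletons A, B with |A| < |B| < imax, then |A ∩ B| ≥ |C| = θ imax > θ|B|, so
-- |A ∩ B| = θ|A| and B ∈ Tor(A), contradicting Tor(A) = ∅.
module Submission where

open import Defs
open import Data.Nat using (ℕ; _≤_; _<_; z≤n)
import Data.Nat.Properties as ℕ
import Data.Nat.Coprimality as Coprimality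
open import Data.Integer using (+_; +≤+; +<+) renaming (_≤_ to _≤ℤ_; _<_ to _<ℤ_)
import Data.Integer.Properties as ℤ
open import Data.Rational using (ℚ; mkℚ; 0ℚ; 1ℚ; _*_; *≤*; *<*; positive; nonNegative)
  renaming (_≤_ to _≤ℚ_; _<_ to _<ℚ_)
import Data.Rational.Properties as ℚ
open import Data.Fin using (zero; suc)
open import Data.Fin.Subset using (Subset; ⊤; _∩_; ∣_∣; _⊆_)
open import Data.Fin.Subset.Properties
  using (_∈?_; ∩-idem; ∩-identityʳ; p∩q⊆q; x∈p∩q⁻; x∈p∩q⁺; p⊆q⇒∣p∣≤∣q∣; p⊂q⇒∣p∣<∣q∣)
open import Data.Vec using (Vec; []; _∷_; lookup)
open import Data.Vec.Relation.Unary.All using ([]; _∷_)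
open import Data.Vec.Relation.Unary.AllPairs using ([]; _∷_)
open import Data.Vec.Relation.Unary.Unique.Propositional using (Unique)
open import Data.Vec.Relation.Unary.Unique.Propositional.Properties using (lookup-injective)
open import Data.Product using (_×_; _,_; proj₁; ∃-syntax)
open import Data.Sum as Sum using (_⊎_; inj₁; inj₂; [_,_])
open import Data.Empty using (⊥)
open import Function using (_∘_)
open import Relation.Binary.PropositionalEquality using (_≡_; _≢_; refl; sym; subst; subst₂)
open import Relation.Nullary using (¬_; yes; no; contradiction)

toℚ≡mkℚ : ∀ k → toℚ k ≡ mkℚ (+ k) 0 (Coprimality.sym (Coprimality.1-coprimeTo k))
toℚ≡mkℚ k = ℚ.↥p/↧p≡p (mkℚ (+ k) 0 _)

toℚ-mono-≤ : ∀ {m n} → m ≤ n → toℚ m ≤ℚ toℚ n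
toℚ-mono-≤ {m} {n} m≤n rewrite toℚ≡mkℚ m | toℚ≡mkℚ n =
  *≤* (subst₂ _≤ℤ_ (sym (ℤ.*-identityʳ (+ m))) (sym (ℤ.*-identityʳ (+ n))) (+≤+ m≤n))

toℚ-cancel-≤ : ∀ {m n} → toℚ m ≤ℚ toℚ n → m ≤ n
toℚ-cancel-≤ {m} {n} le rewrite toℚ≡mkℚ m | toℚ≡mkℚ n with *≤* m≤n ← le =
  ℤ.drop‿+≤+ (subst₂ _≤ℤ_ (ℤ.*-identityʳ (+ m)) (ℤ.*-identityʳ (+ n)) m≤n)

toℚ-mono-< : ∀ {m n} → m < n → toℚ m <ℚ toℚ n
toℚ-mono-< {m} {n} m<n rewrite toℚ≡mkℚ m | toℚ≡mkℚ n =
  *<* (subst₂ _<ℤ_ (sym (ℤ.*-identityʳ (+ m))) (sym (ℤ.*-identityʳ (+ n))) (+<+ m<n))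

*-toℚ-<-toℚ : ∀ {θ m} → θ <ℚ 1ℚ → 0 < m → θ * toℚ m <ℚ toℚ m
*-toℚ-<-toℚ {θ} {m} θ<1 0<m = subst (θ * toℚ m <ℚ_) (ℚ.*-identityˡ (toℚ m))
  (ℚ.*-monoˡ-<-pos (toℚ m) {{positive (toℚ-mono-< 0<m)}} θ<1)

∣q∣≤∣p∩q∣⇒q⊆p : ∀ {n} (p q : Subset n) → ∣ q ∣ ≤ ∣ p ∩ q ∣ → q ⊆ p
∣q∣≤∣p∩q∣⇒q⊆p p q ∣q∣≤∣p∩q∣ {x} x∈q with x ∈? p
... | yes x∈p = x∈p
... | no x∉p = contradiction ∣q∣≤∣p∩q∣
  (ℕ.<⇒≱ (p⊂q⇒∣p∣<∣q∣ (p∩q⊆q p q , x , x∈q , x∉p ∘ proj₁ ∘ x∈p∩q⁻ p q)))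

∣p∣<∣q∣⇒p≢q : ∀ {n} {p q : Subset n} → ∣ p ∣ < ∣ q ∣ → p ≢ q
∣p∣<∣q∣⇒p≢q ∣p∣<∣p∣ refl = ℕ.<-irrefl refl ∣p∣<∣p∣

TorEmpty : ∀ {n} → ℚ → Family n → Subset n → Set
TorEmpty θ F A = ∀ B → ¬ InTor θ F A B

module Tor {n : ℕ} (θ : ℚ) (F : Family n) where

  InTor⇒≢ : ∀ {A B} → θ <ℚ 1ℚ → 0 < ∣ A ∣ → InTor θ F A B → A ≢ B
  InTor⇒≢ {A} θ<1 0<∣A∣ (_ , _ , ∣A∩A∣≡θ∣A∣) refl =
    ℚ.<-irrefl (sym ∣A∣≡θ∣A∣) (*-toℚ-<-toℚ θ<1 0<∣A∣)
    where
    ∣A∣≡θ∣A∣ : toℚ ∣ A ∣ ≡ θ * toℚ ∣ A ∣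
    ∣A∣≡θ∣A∣ = subst (λ X → toℚ ∣ X ∣ ≡ θ * toℚ ∣ A ∣) (∩-idem A) ∣A∩A∣≡θ∣A∣

  exceptional-singleton⇒TorEmpty : ∀ {i A} →
    InSexc θ F i → LayerIsSingleton F i A → TorEmpty θ F A
  exceptional-singleton⇒TorEmpty (i∈S , i∉Snor) (_ , _ , unique) B B∈Tor =
    i∉Snor (i∈S , λ A′ FA′ ∣A′∣≡i →
      B , subst (λ X → InTor θ F X B) (sym (unique A′ FA′ ∣A′∣≡i)) B∈Tor)

module _ {n r : ℕ} {θ : ℚ} {F : Family n} (closed : RClosedThetaIntersecting r θ F) where

  open Tor θ F

  intersect₂ : ∀ {A B} → 2 ≤ r → F A → F B → A ≢ B →
    toℚ ∣ A ∩ B ∣ ≡ θ * toℚ ∣ A ∣ ⊎ toℚ ∣ A ∩ B ∣ ≡ θ * toℚ ∣ B ∣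
  intersect₂ {A} {B} 2≤r FA FB A≢B =
    read (closed 2 ℕ.≤-refl 2≤r As (λ {i} {j} → lookup-injective distinct i j) member)
    where
    As : Vec (Subset n) 2
    As = A ∷ B ∷ []
    distinct : Unique As
    distinct = (A≢B ∷ []) ∷ [] ∷ []
    member : ∀ k → F (lookup As k)
    member zero = FA
    member (suc zero) = FB
    drop-⊤ : ∀ {q} → toℚ ∣ A ∩ (B ∩ ⊤) ∣ ≡ q → toℚ ∣ A ∩ B ∣ ≡ q
    drop-⊤ {q} = subst (λ X → toℚ ∣ A ∩ X ∣ ≡ q) (∩-identityʳ B)
    read : ∃[ k ] toℚ ∣ ⋂ As ∣ ≡ θ * toℚ ∣ lookup As k ∣ →
      toℚ ∣ A ∩ B ∣ ≡ θ * toℚ ∣ A ∣ ⊎ toℚ ∣ A ∩ B ∣ ≡ θ * toℚ ∣ B ∣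
    read (zero , eq) = inj₁ (drop-⊤ eq)
    read (suc zero , eq) = inj₂ (drop-⊤ eq)

  intersect₃ : ∀ {A B C} → 3 ≤ r → F A → F B → F C → A ≢ B → A ≢ C → B ≢ C →
    toℚ ∣ A ∩ (B ∩ C) ∣ ≡ θ * toℚ ∣ A ∣ ⊎ toℚ ∣ A ∩ (B ∩ C) ∣ ≡ θ * toℚ ∣ B ∣
      ⊎ toℚ ∣ A ∩ (B ∩ C) ∣ ≡ θ * toℚ ∣ C ∣
  intersect₃ {A} {B} {C} 3≤r FA FB FC A≢B A≢C B≢C =
    read (closed 3 (ℕ.n≤1+n 2) 3≤r As (λ {i} {j} → lookup-injective distinct i j) member)
    where
    As : Vec (Subset n) 3
    As = A ∷ B ∷ C ∷ []
    distinct : Unique As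
    distinct = (A≢B ∷ A≢C ∷ []) ∷ (B≢C ∷ []) ∷ [] ∷ []
    member : ∀ k → F (lookup As k)
    member zero = FA
    member (suc zero) = FB
    member (suc (suc zero)) = FC
    drop-⊤ : ∀ {q} → toℚ ∣ A ∩ (B ∩ (C ∩ ⊤)) ∣ ≡ q → toℚ ∣ A ∩ (B ∩ C) ∣ ≡ q
    drop-⊤ {q} = subst (λ X → toℚ ∣ A ∩ (B ∩ X) ∣ ≡ q) (∩-identityʳ C)
    read : ∃[ k ] toℚ ∣ ⋂ As ∣ ≡ θ * toℚ ∣ lookup As k ∣ →
      toℚ ∣ A ∩ (B ∩ C) ∣ ≡ θ * toℚ ∣ A ∣ ⊎ toℚ ∣ A ∩ (B ∩ C) ∣ ≡ θ * toℚ ∣ B ∣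
        ⊎ toℚ ∣ A ∩ (B ∩ C) ∣ ≡ θ * toℚ ∣ C ∣
    read (zero , eq) = inj₁ (drop-⊤ eq)
    read (suc zero , eq) = inj₂ (inj₁ (drop-⊤ eq))
    read (suc (suc zero) , eq) = inj₂ (inj₂ (drop-⊤ eq))

  core-dichotomy : ∀ {A A′ B′} → 3 ≤ r → 0ℚ <ℚ θ → θ <ℚ 1ℚ →
    F A → F A′ → InTor θ F A′ B′ → ∣ A ∣ < ∣ A′ ∣ →
    toℚ ∣ A ∩ (A′ ∩ B′) ∣ ≡ θ * toℚ ∣ A ∣ ⊎ A′ ∩ B′ ⊆ A
  core-dichotomy {A} {A′} {B′} 3≤r 0<θ θ<1 FA FA′ B′∈Tor@(FB′ , ∣A′∣≤∣B′∣ , ∣core∣≡θ∣A′∣) ∣A∣<∣A′∣ =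
    Sum.map₂ (∣q∣≤∣p∩q∣⇒q⊆p A (A′ ∩ B′) ∘ toℚ-cancel-≤)
      (Sum.map₂ [ core≤ A′ ℕ.≤-refl , core≤ B′ ∣A′∣≤∣B′∣ ] (intersect₃ 3≤r FA FA′ FB′ A≢A′ A≢B′ A′≢B′))
    where
    A≢A′ : A ≢ A′
    A≢A′ = ∣p∣<∣q∣⇒p≢q ∣A∣<∣A′∣
    A≢B′ : A ≢ B′
    A≢B′ = ∣p∣<∣q∣⇒p≢q (ℕ.<-≤-trans ∣A∣<∣A′∣ ∣A′∣≤∣B′∣)
    A′≢B′ : A′ ≢ B′
    A′≢B′ = InTor⇒≢ θ<1 (ℕ.≤-<-trans z≤n ∣A∣<∣A′∣) B′∈Tor
    core≤ : ∀ X → ∣ A′ ∣ ≤ ∣ X ∣ → toℚ ∣ A ∩ (A′ ∩ B′) ∣ ≡ θ * toℚ ∣ X ∣ →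
      toℚ ∣ A′ ∩ B′ ∣ ≤ℚ toℚ ∣ A ∩ (A′ ∩ B′) ∣
    core≤ X ∣A′∣≤∣X∣ eq = begin
      toℚ ∣ A′ ∩ B′ ∣         ≡⟨ ∣core∣≡θ∣A′∣ ⟩
      θ * toℚ ∣ A′ ∣           ≤⟨ ℚ.*-monoˡ-≤-nonNeg θ {{nonNegative (ℚ.<⇒≤ 0<θ)}} (toℚ-mono-≤ ∣A′∣≤∣X∣) ⟩
      θ * toℚ ∣ X ∣            ≡⟨ eq ⟨
      toℚ ∣ A ∩ (A′ ∩ B′) ∣   ∎
      where open ℚ.≤-Reasoning

  core-in-two-smaller-layers⇒⊥ : ∀ {m A B C} → 2 ≤ r → 0ℚ <ℚ θ → toℚ ∣ C ∣ ≡ θ * toℚ m →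
    F A → F B → TorEmpty θ F A → ∣ A ∣ < ∣ B ∣ → ∣ B ∣ < m → C ⊆ A → C ⊆ B → ⊥
  core-in-two-smaller-layers⇒⊥ {m} {A} {B} {C} 2≤r 0<θ ∣C∣≡θm FA FB Tor-A-empty ∣A∣<∣B∣ ∣B∣<m C⊆A C⊆B =
    [ ∣A∩B∣≢θ∣A∣ , ∣A∩B∣≢θ∣B∣ ] (intersect₂ 2≤r FA FB (∣p∣<∣q∣⇒p≢q ∣A∣<∣B∣))
    where
    ∣A∩B∣≢θ∣A∣ : ¬ toℚ ∣ A ∩ B ∣ ≡ θ * toℚ ∣ A ∣
    ∣A∩B∣≢θ∣A∣ eq = Tor-A-empty B (FB , ℕ.<⇒≤ ∣A∣<∣B∣ , eq)
    ∣A∩B∣≢θ∣B∣ : ¬ toℚ ∣ A ∩ B ∣ ≡ θ * toℚ ∣ B ∣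
    ∣A∩B∣≢θ∣B∣ eq = ℕ.<⇒≱ ∣B∣<m (toℚ-cancel-≤ (ℚ.*-cancelˡ-≤-pos θ {{positive 0<θ}} (begin
      θ * toℚ m       ≡⟨ ∣C∣≡θm ⟨
      toℚ ∣ C ∣       ≤⟨ toℚ-mono-≤ (p⊆q⇒∣p∣≤∣q∣ (λ x∈C → x∈p∩q⁺ (C⊆A x∈C , C⊆B x∈C))) ⟩
      toℚ ∣ A ∩ B ∣   ≡⟨ eq ⟩
      θ * toℚ ∣ B ∣   ∎)))
      where open ℚ.≤-Reasoning

  exceptional-singletons-containing-core-unique : ∀ {m i j A B C} → 2 ≤ r → 0ℚ <ℚ θ →
    toℚ ∣ C ∣ ≡ θ * toℚ m →
    InSexc θ F i → i < m → LayerIsSingleton F i A → C ⊆ A →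
    InSexc θ F j → j < m → LayerIsSingleton F j B → C ⊆ B → i ≡ j
  exceptional-singletons-containing-core-unique 2≤r 0<θ ∣C∣≡θm
    i∈Sexc i<m A-layer@(FA , refl , _) C⊆A j∈Sexc j<m B-layer@(FB , refl , _) C⊆B =
    ℕ.≤-antisym
      (ℕ.≮⇒≥ λ ∣B∣<∣A∣ → core-in-two-smaller-layers⇒⊥ 2≤r 0<θ ∣C∣≡θm FB FA
        (exceptional-singleton⇒TorEmpty j∈Sexc B-layer) ∣B∣<∣A∣ i<m C⊆B C⊆A)
      (ℕ.≮⇒≥ λ ∣A∣<∣B∣ → core-in-two-smaller-layers⇒⊥ 2≤r 0<θ ∣C∣≡θm FA FB
        (exceptional-singleton⇒TorEmpty i∈Sexc A-layer) ∣A∣<∣B∣ j<m C⊆A C⊆B)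

lemma2p19 : (n r : ℕ) (θ : ℚ) (F : Family n) →
    3 ≤ r → 0ℚ <ℚ θ → θ <ℚ 1ℚ →
    RClosedThetaIntersecting r θ F →
    ∃[ j ] InSnor θ F j →
    (imax : ℕ) → IsMaxSnor θ F imax →
    (C : Subset n) → IsCoreOf θ F imax C →
    ((i : ℕ) (A : Subset n) → InSexc θ F i → i < imax → LayerIsSingleton F i A →
      (toℚ ∣ A ∩ C ∣ ≡ θ * toℚ i) ⊎ (C ⊆ A))
    × ((i j : ℕ) (A B : Subset n) →
      InSexc θ F i → i < imax → LayerIsSingleton F i A → C ⊆ A →
      InSexc θ F j → j < imax → LayerIsSingleton F j B → C ⊆ B →
      i ≡ j)
lemma2p19 n r θ F 3≤r 0<θ θ<1 closed _ _ _ _ (A′ , B′ , FA′ , refl , B′∈Tor@(_ , _ , ∣C∣≡θimax) , refl) =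
  (λ { _ _ _ ∣A∣<imax (FA , refl , _) → core-dichotomy closed 3≤r 0<θ θ<1 FA FA′ B′∈Tor ∣A∣<imax })
  , (λ _ _ _ _ → exceptional-singletons-containing-core-unique closed (ℕ.≤-trans (ℕ.n≤1+n 2) 3≤r) 0<θ ∣C∣≡θimax)
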